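{- Let $G$ be a connected graph. Then $G$ is isomorphic to the path $P_4$ if and only if the line graph $L(G)$ is stepwise irregular.
   Context: All graphs are finite and simple. A graph $G$ is stepwise irregular (SI) if for every edge $uv\in E(G)$ one has $|d_G(u)-d_G(v)|=1$, where $d_G$ denotes degree. $P_4$ is the path with $4$ vertices. The line graph $L(G)$ has vertex set $E(G)$, two vertices of $L(G)$ being adjacent iff the corresponding edges of $G$ share an endpoint. -}

module Defs where

open import Data.Nat using (ℕ; zero; suc; _≤_; _<ᵇ_)
open import Data.Fin using (Fin; toℕ; _≟_)
open import Data.Bool using (Bool; true; false; if_then_else_; _∧_; _∨_; not)
open import Data.List using (List; allFin; concatMap; map; filterᵇ; length; lookup)
open import Data.Nat.ListAction using (sum)
open import Data.Bool.Properties using (∨-comm; ∨-assoc)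
open import Relation.Binary.PropositionalEquality using (cong; cong₂) renaming (sym to ≡-sym)
open import Relation.Nullary using (yes; no)
open import Data.Empty using (⊥-elim)
open import Data.Product using (_×_; _,_; proj₁; proj₂; Σ)
open import Data.Sum using (_⊎_)
open import Function.Bundles using (_↔_; Inverse)
open import Relation.Nullary using (does)
open import Relation.Binary.PropositionalEquality using (_≡_; refl)

record Graph : Set where
  field
    n      : ℕ
    adj    : Fin n → Fin n → Bool
    sym    : ∀ u v → adj u v ≡ adj v u
    irrefl : ∀ v → adj v v ≡ false
open Graph public

degree : (G : Graph) → Fin (n G) → ℕ
degree G u = sum (map (λ v → if adj G u v then 1 else 0) (allFin (n G)))

StepwiseIrregular : Graph → Set
StepwiseIrregular G = ∀ u v → adj G u v ≡ true →
  (degree G u ≡ suc (degree G v)) ⊎ (degree G v ≡ suc (degree G u))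

data Walk (G : Graph) : Fin (n G) → Fin (n G) → Set where
  here : ∀ {u} → Walk G u u
  step : ∀ {u w v} → adj G u w ≡ true → Walk G w v → Walk G u v

Connected : Graph → Set
Connected G = ∀ u v → Walk G u v

_≅_ : Graph → Graph → Set
G ≅ H = Σ (Fin (n G) ↔ Fin (n H)) λ f →
  ∀ u v → adj G u v ≡ adj H (Inverse.to f u) (Inverse.to f v)

p4adj : Fin 4 → Fin 4 → Bool
p4adj i j = (suc (toℕ i) Data.Nat.≡ᵇ toℕ j) ∨ (suc (toℕ j) Data.Nat.≡ᵇ toℕ i)
  where import Data.Nat

p4sym : ∀ i j → p4adj i j ≡ p4adj j i
p4sym Fin.zero Fin.zero = refl
p4sym Fin.zero (Fin.suc Fin.zero) = refl
p4sym Fin.zero (Fin.suc (Fin.suc Fin.zero)) = refl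
p4sym Fin.zero (Fin.suc (Fin.suc (Fin.suc Fin.zero))) = refl
p4sym (Fin.suc Fin.zero) Fin.zero = refl
p4sym (Fin.suc Fin.zero) (Fin.suc Fin.zero) = refl
p4sym (Fin.suc Fin.zero) (Fin.suc (Fin.suc Fin.zero)) = refl
p4sym (Fin.suc Fin.zero) (Fin.suc (Fin.suc (Fin.suc Fin.zero))) = refl
p4sym (Fin.suc (Fin.suc Fin.zero)) Fin.zero = refl
p4sym (Fin.suc (Fin.suc Fin.zero)) (Fin.suc Fin.zero) = refl
p4sym (Fin.suc (Fin.suc Fin.zero)) (Fin.suc (Fin.suc Fin.zero)) = refl
p4sym (Fin.suc (Fin.suc Fin.zero)) (Fin.suc (Fin.suc (Fin.suc Fin.zero))) = refl
p4sym (Fin.suc (Fin.suc (Fin.suc Fin.zero))) Fin.zero = refl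
p4sym (Fin.suc (Fin.suc (Fin.suc Fin.zero))) (Fin.suc Fin.zero) = refl
p4sym (Fin.suc (Fin.suc (Fin.suc Fin.zero))) (Fin.suc (Fin.suc Fin.zero)) = refl
p4sym (Fin.suc (Fin.suc (Fin.suc Fin.zero))) (Fin.suc (Fin.suc (Fin.suc Fin.zero))) = refl

p4irr : ∀ i → p4adj i i ≡ false
p4irr Fin.zero = refl
p4irr (Fin.suc Fin.zero) = refl
p4irr (Fin.suc (Fin.suc Fin.zero)) = refl
p4irr (Fin.suc (Fin.suc (Fin.suc Fin.zero))) = refl

P₄ : Graph
P₄ = record { n = 4 ; adj = p4adj ; sym = p4sym ; irrefl = p4irr }

edges : (G : Graph) → List (Fin (n G) × Fin (n G))
edges G = filterᵇ (λ p → (toℕ (proj₁ p) <ᵇ toℕ (proj₂ p)) ∧ adj G (proj₁ p) (proj₂ p))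
  (concatMap (λ u → map (u ,_) (allFin (n G))) (allFin (n G)))

edgeAt : (G : Graph) → Fin (length (edges G)) → Fin (n G) × Fin (n G)
edgeAt G = lookup (edges G)

shareEnd : ∀ {m} → Fin m × Fin m → Fin m × Fin m → Bool
shareEnd (a , b) (c , d) = does (a ≟ c) ∨ does (a ≟ d) ∨ does (b ≟ c) ∨ does (b ≟ d)

lineAdj : (G : Graph) → Fin (length (edges G)) → Fin (length (edges G)) → Bool
lineAdj G i j = not (does (i ≟ j)) ∧ shareEnd (edgeAt G i) (edgeAt G j)

doesSym : ∀ {m} (i j : Fin m) → does (i ≟ j) ≡ does (j ≟ i)
doesSym i j with i ≟ j | j ≟ i
... | yes _ | yes _ = refl
... | no _  | no _  = refl
... | yes p | no q  = ⊥-elim (q (≡-sym p))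
... | no p  | yes q = ⊥-elim (p (≡-sym q))

shareSym : ∀ {m} (e f : Fin m × Fin m) → shareEnd e f ≡ shareEnd f e
shareSym (a , b) (c , d)
  rewrite doesSym a c | doesSym a d | doesSym b c | doesSym b d
  with does (c ≟ a) | does (d ≟ a) | does (c ≟ b) | does (d ≟ b)
... | true  | _ | _ | _ = refl
... | false | true | true | _ = refl
... | false | true | false | _ = refl
... | false | false | true | _ = refl
... | false | false | false | x = refl

lineSym : (G : Graph) → ∀ i j → lineAdj G i j ≡ lineAdj G j i
lineSym G i j = cong₂ (λ x y → not x ∧ y) (doesSym i j) (shareSym (edgeAt G i) (edgeAt G j))

lineIrr : (G : Graph) → ∀ i → lineAdj G i i ≡ false
lineIrr G i with i ≟ i
... | yes _ = refl
... | no q = ⊥-elim (q refl)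

L : Graph → Graph
L G = record { n = length (edges G) ; adj = lineAdj G ; sym = lineSym G ; irrefl = lineIrr G }

-- If the edge e joins a and b, then d_L(e) = d(a) + d(b) - 2, so L(G) is stepwise irregular iff
-- any two distinct neighbours of a common vertex have degrees differing by one. No three numbers
-- differ pairwise by one, so then every degree is at most 2. Being connected with at least three
-- vertices, G has a vertex v with distinct neighbours a and b, say d(b) = d(a) + 1. This forces
-- d(v) = d(b) = 2 and d(a) = 1, and the other neighbour c of b must have d(c) = 1. Hence {a, v, b, c}
-- is closed under adjacency, and by connectivity G is the path a - v - b - c. Conversely P₄ satisfies
-- the condition on neighbours, which is invariant under isomorphism.

module Submission where

open import Defs hiding (sym)

open import Data.Bool as Bool using (Bool; true; false; _∧_; _∨_; not; if_then_else_)
open import Data.Bool.Properties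
  using (∧-identityʳ; ∧-zeroʳ; ∧-comm; ∧-conicalˡ; ∧-conicalʳ; ∧-distribˡ-∨; ∨-assoc; ∨-comm; ∨-zeroʳ; ∨-identityʳ; ¬-not; T-≡)
open import Data.Empty using (⊥; ⊥-elim)
open import Data.Fin using (Fin; zero; suc; toℕ; _≟_; punchIn)
open import Data.Fin.Patterns using (0F; 1F; 2F; 3F)
open import Data.Fin.Properties using (punchInᵢ≢i; any?; all?; toℕ-injective)
open import Data.List using (List; []; _∷_; _++_; map; tabulate; allFin; filterᵇ; concatMap; cartesianProduct; lookup; length)
open import Data.List.Properties using (map-++; map-∘)
open import Data.List.Membership.Propositional using (_∈_)
open import Data.List.Membership.Propositional.Properties
  using (∈-lookup; ∈-filter⁺; ∈-filter⁻; ∈-cartesianProduct⁺; ∈-allFin)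
open import Data.List.Relation.Unary.All as All using ()
open import Data.List.Relation.Unary.AllPairs using (_∷_)
open import Data.List.Relation.Unary.Any using (index)
open import Data.List.Relation.Unary.Any.Properties using (lookup-index)
open import Data.List.Relation.Unary.Unique.Propositional using (Unique)
open import Data.List.Relation.Unary.Unique.Propositional.Properties using (filter⁺; cartesianProduct⁺; allFin⁺)
open import Data.Nat as ℕ using (ℕ; zero; suc; _+_; _≤_; _<_; _<ᵇ_; s≤s; s≤s⁻¹; z≤n)
open import Data.Nat.ListAction using (sum)
open import Data.Nat.ListAction.Properties using (sum-++)
open import Data.Nat.Properties
  using (+-identityʳ; +-comm; +-suc; +-cancelˡ-≡; ≤-trans; ≤-antisym; ≤-reflexive; <⇒≱; ≮⇒≥;
         <ᵇ⇒<; <⇒<ᵇ; <-cmp; <-asym; suc-injective; +-0-commutativeMonoid)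
open import Algebra.Properties.CommutativeMonoid.Sum +-0-commutativeMonoid
  using (sum-syntax; sum-cong-≗; ∑-distrib-+; ∑-permute; sum-remove; sum-replicate-zero)
  renaming (sum to ∑)
open import Data.Product using (Σ; _×_; _,_; proj₁; proj₂)
open import Data.Sum using (_⊎_; inj₁; inj₂; [_,_]′) renaming (swap to ⊎-swap)
open import Function using (_∘_; id; case_of_; _↔_; _⇔_; Inverse; Equivalence; mk⇔; mk↔ₛ′)
open import Relation.Binary using (tri<; tri≈; tri>)
open import Relation.Binary.PropositionalEquality
open import Relation.Nullary using (Dec; does; yes; no; ¬_)
open import Relation.Nullary.Decidable using (T?; dec-true; dec-false; from-yes; ¬?; _→-dec_; _⊎-dec_)
open import Relation.Nullary.Negation using (contradiction)

∧-true⁻ : ∀ {x y} → x ∧ y ≡ true → x ≡ true × y ≡ true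
∧-true⁻ {x} {y} x∧y = ∧-conicalˡ x y x∧y , ∧-conicalʳ x y x∧y

∨-true⁻ : ∀ {x y} → x ∨ y ≡ true → x ≡ true ⊎ y ≡ true
∨-true⁻ {true}  _    = inj₁ refl
∨-true⁻ {false} y≡tt = inj₂ y≡tt

∨-true⁺ : ∀ {x y} → x ≡ true ⊎ y ≡ true → x ∨ y ≡ true
∨-true⁺         (inj₁ refl) = refl
∨-true⁺ {x = x} (inj₂ refl) = ∨-zeroʳ x

<ᵇ-true : ∀ {m n} → m < n → (m <ᵇ n) ≡ true
<ᵇ-true m<n = Equivalence.to T-≡ (<⇒<ᵇ m<n)

<ᵇ-false : ∀ {m n} → ¬ m < n → (m <ᵇ n) ≡ false
<ᵇ-false {m} {n} m≮n = ¬-not (m≮n ∘ <ᵇ⇒< m n ∘ Equivalence.from T-≡)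

-- Counting

iverson : Bool → ℕ
iverson b = if b then 1 else 0

count : ∀ {n} → (Fin n → Bool) → ℕ
count {n} p = ∑[ i < n ] iverson (p i)

∑-δ : ∀ {n} (f : Fin n → ℕ) (a : Fin n) → (∀ i → i ≢ a → f i ≡ 0) → ∑ f ≡ f a
∑-δ {suc n} f a f≡0 = begin
  ∑ f                              ≡⟨ sum-remove f ⟩
  f a + ∑[ i < n ] f (punchIn a i) ≡⟨ cong (f a +_) (sum-cong-≗ (λ i → f≡0 _ (punchInᵢ≢i a i))) ⟩
  f a + ∑[ i < n ] 0               ≡⟨ cong (f a +_) (sum-replicate-zero n) ⟩
  f a + 0                          ≡⟨ +-identityʳ (f a) ⟩
  f a                              ∎
  where open ≡-Reasoning

count-permute : ∀ {m n} (π : Fin m ↔ Fin n) (p : Fin n → Bool) → count (p ∘ Inverse.to π) ≡ count p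
count-permute π p = sym (∑-permute (iverson ∘ p) π)

module _ {n : ℕ} where

  count-cong : {p q : Fin n → Bool} → (∀ i → p i ≡ q i) → count p ≡ count q
  count-cong p≗q = sum-cong-≗ (cong iverson ∘ p≗q)

  count-false : {p : Fin n → Bool} → (∀ i → p i ≡ false) → count p ≡ 0
  count-false p≡false = trans (count-cong p≡false) (sum-replicate-zero n)

  count-∨-∧ : (p q : Fin n → Bool) →
              count (λ i → p i ∨ q i) + count (λ i → p i ∧ q i) ≡ count p + count q
  count-∨-∧ p q = begin
    count (λ i → p i ∨ q i) + count (λ i → p i ∧ q i)
      ≡⟨ ∑-distrib-+ (λ i → iverson (p i ∨ q i)) (λ i → iverson (p i ∧ q i)) ⟨
    ∑[ i < n ] (iverson (p i ∨ q i) + iverson (p i ∧ q i))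
      ≡⟨ sum-cong-≗ (λ i → pointwise (p i) (q i)) ⟩
    ∑[ i < n ] (iverson (p i) + iverson (q i))
      ≡⟨ ∑-distrib-+ (iverson ∘ p) (iverson ∘ q) ⟩
    count p + count q
      ∎
    where
    open ≡-Reasoning
    pointwise : ∀ x y → iverson (x ∨ y) + iverson (x ∧ y) ≡ iverson x + iverson y
    pointwise true  true  = refl
    pointwise true  false = refl
    pointwise false true  = refl
    pointwise false false = refl

  count-∨-disjoint : (p q : Fin n → Bool) → (∀ i → p i ∧ q i ≡ false) →
                     count (λ i → p i ∨ q i) ≡ count p + count q
  count-∨-disjoint p q disjoint = begin
    count (λ i → p i ∨ q i)                           ≡⟨ +-identityʳ _ ⟨
    count (λ i → p i ∨ q i) + 0                       ≡⟨ cong (count (λ i → p i ∨ q i) +_) (count-false disjoint) ⟨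
    count (λ i → p i ∨ q i) + count (λ i → p i ∧ q i) ≡⟨ count-∨-∧ p q ⟩
    count p + count q                                 ∎
    where open ≡-Reasoning

  count-∧-≟ : (p : Fin n → Bool) (a : Fin n) → count (λ i → does (a ≟ i) ∧ p i) ≡ iverson (p a)
  count-∧-≟ p a = trans (∑-δ _ a off-a) (cong (λ d → iverson (d ∧ p a)) (dec-true (a ≟ a) refl))
    where
    off-a : ∀ i → i ≢ a → iverson (does (a ≟ i) ∧ p i) ≡ 0
    off-a i i≢a = cong (λ d → iverson (d ∧ p i)) (dec-false (a ≟ i) (i≢a ∘ sym))

  count-≟ : (a : Fin n) → count (λ i → does (a ≟ i)) ≡ 1
  count-≟ a = trans (count-cong (λ i → sym (∧-identityʳ (does (a ≟ i))))) (count-∧-≟ (λ _ → true) a)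

  infixl 6 _∖_
  _∖_ : (Fin n → Bool) → Fin n → Fin n → Bool
  (p ∖ a) i = not (does (a ≟ i)) ∧ p i

  ∖-true⁺ : (p : Fin n → Bool) {a i : Fin n} → p i ≡ true → i ≢ a → (p ∖ a) i ≡ true
  ∖-true⁺ p {a} {i} pi i≢a rewrite dec-false (a ≟ i) (i≢a ∘ sym) = pi

  ∖-true⁻ : (p : Fin n → Bool) (a : Fin n) {i : Fin n} → (p ∖ a) i ≡ true → p i ≡ true × i ≢ a
  ∖-true⁻ p a {i} p∖ai with a ≟ i
  ... | no a≢i = p∖ai , a≢i ∘ sym

  count-remove : (p : Fin n → Bool) (a : Fin n) → p a ≡ true → count p ≡ suc (count (p ∖ a))
  count-remove p a pa = begin
    count p                                             ≡⟨ count-cong covers ⟨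
    count (λ i → (does (a ≟ i) ∧ p i) ∨ (p ∖ a) i)      ≡⟨ count-∨-disjoint _ (p ∖ a) disjoint ⟩
    count (λ i → does (a ≟ i) ∧ p i) + count (p ∖ a)    ≡⟨ cong (_+ count (p ∖ a)) (count-∧-≟ p a) ⟩
    iverson (p a) + count (p ∖ a)                       ≡⟨ cong (λ b → iverson b + count (p ∖ a)) pa ⟩
    suc (count (p ∖ a))                                 ∎
    where
    open ≡-Reasoning
    covers : ∀ i → (does (a ≟ i) ∧ p i) ∨ (p ∖ a) i ≡ p i
    covers i with a ≟ i
    ... | yes refl = ∨-identityʳ (p a)
    ... | no  _    = refl
    disjoint : ∀ i → (does (a ≟ i) ∧ p i) ∧ (p ∖ a) i ≡ false
    disjoint i with a ≟ i
    ... | yes refl = ∧-zeroʳ (p a)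
    ... | no  _    = refl

  count-∖-≥ : (p : Fin n → Bool) (a : Fin n) → p a ≡ true → ∀ {k} → suc k ≤ count p → k ≤ count (p ∖ a)
  count-∖-≥ p a pa k<p = s≤s⁻¹ (subst (_ ≤_) (count-remove p a pa) k<p)

  count-≥1 : (p : Fin n → Bool) {a : Fin n} → p a ≡ true → 1 ≤ count p
  count-≥1 p {a} pa = subst (1 ≤_) (sym (count-remove p a pa)) (s≤s z≤n)

  count-≥2 : (p : Fin n → Bool) {a b : Fin n} → p a ≡ true → p b ≡ true → a ≢ b → 2 ≤ count p
  count-≥2 p {a} pa pb a≢b =
    subst (2 ≤_) (sym (count-remove p a pa)) (s≤s (count-≥1 (p ∖ a) (∖-true⁺ p pb (a≢b ∘ sym))))

  count-≥3 : (p : Fin n → Bool) {a b c : Fin n} → p a ≡ true → p b ≡ true → p c ≡ true →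
             a ≢ b → a ≢ c → b ≢ c → 3 ≤ count p
  count-≥3 p {a} pa pb pc a≢b a≢c b≢c =
    subst (3 ≤_) (sym (count-remove p a pa))
      (s≤s (count-≥2 (p ∖ a) (∖-true⁺ p pb (a≢b ∘ sym)) (∖-true⁺ p pc (a≢c ∘ sym)) b≢c))

  count≤1-unique : (p : Fin n → Bool) {a b : Fin n} → count p ≤ 1 → p a ≡ true → p b ≡ true → a ≡ b
  count≤1-unique p {a} {b} p≤1 pa pb with a ≟ b
  ... | yes a≡b = a≡b
  ... | no  a≢b = contradiction p≤1 (<⇒≱ (count-≥2 p pa pb a≢b))

  count≤2-cover : (p : Fin n → Bool) {a b c : Fin n} → count p ≤ 2 →
                  p a ≡ true → p b ≡ true → a ≢ b → p c ≡ true → c ≡ a ⊎ c ≡ b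
  count≤2-cover p {a} {b} {c} p≤2 pa pb a≢b pc with c ≟ a | c ≟ b
  ... | yes c≡a | _       = inj₁ c≡a
  ... | no  _   | yes c≡b = inj₂ c≡b
  ... | no  c≢a | no  c≢b = contradiction p≤2 (<⇒≱ (count-≥3 p pa pb pc a≢b (c≢a ∘ sym) (c≢b ∘ sym)))

  count-witness : (p : Fin n → Bool) → 1 ≤ count p → Σ (Fin n) λ i → p i ≡ true
  count-witness p 1≤p with any? (λ i → p i Bool.≟ true)
  ... | yes witness = witness
  ... | no  none    = contradiction (subst (1 ≤_) (count-false (λ i → ¬-not (none ∘ (i ,_)))) 1≤p) λ ()

  two-witnesses : (p : Fin n → Bool) → 2 ≤ count p →
                  Σ (Fin n) λ a → Σ (Fin n) λ b → p a ≡ true × p b ≡ true × a ≢ b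
  two-witnesses p 2≤p =
    let a , pa      = count-witness p (≤-trans (s≤s z≤n) 2≤p)
        b , p∖ab    = count-witness (p ∖ a) (count-∖-≥ p a pa 2≤p)
        pb , b≢a    = ∖-true⁻ p a p∖ab
    in a , b , pa , pb , b≢a ∘ sym

  three-witnesses : (p : Fin n → Bool) → 3 ≤ count p →
                    Σ (Fin n) λ a → Σ (Fin n) λ b → Σ (Fin n) λ c →
                    p a ≡ true × p b ≡ true × p c ≡ true × a ≢ b × a ≢ c × b ≢ c
  three-witnesses p 3≤p =
    let a , pa                      = count-witness p (≤-trans (s≤s z≤n) 3≤p)
        b , c , p∖ab , p∖ac , b≢c   = two-witnesses (p ∖ a) (count-∖-≥ p a pa 3≤p)
        pb , b≢a                    = ∖-true⁻ p a p∖ab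
        pc , c≢a                    = ∖-true⁻ p a p∖ac
    in a , b , c , pa , pb , pc , b≢a ∘ sym , c≢a ∘ sym , b≢c

module _ {A : Set} where

  ∑-lookup : (f : A → ℕ) (xs : List A) → ∑[ i < length xs ] f (lookup xs i) ≡ sum (map f xs)
  ∑-lookup f []       = refl
  ∑-lookup f (x ∷ xs) = cong (f x +_) (∑-lookup f xs)

  sum-map-tabulate : ∀ {n} (f : A → ℕ) (g : Fin n → A) → sum (map f (tabulate g)) ≡ ∑[ i < n ] f (g i)
  sum-map-tabulate {zero}  f g = refl
  sum-map-tabulate {suc n} f g = cong (f (g zero) +_) (sum-map-tabulate f (g ∘ suc))

  sum-map-filterᵇ : (p q : A → Bool) (xs : List A) →
                    sum (map (iverson ∘ q) (filterᵇ p xs)) ≡ sum (map (λ x → iverson (p x ∧ q x)) xs)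
  sum-map-filterᵇ p q []       = refl
  sum-map-filterᵇ p q (x ∷ xs) with p x
  ... | true  = cong (iverson (q x) +_) (sum-map-filterᵇ p q xs)
  ... | false = sum-map-filterᵇ p q xs

  sum-map-concatMap : ∀ {B : Set} (f : B → ℕ) (g : A → List B) (xs : List A) →
                      sum (map f (concatMap g xs)) ≡ sum (map (λ x → sum (map f (g x))) xs)
  sum-map-concatMap f g []       = refl
  sum-map-concatMap f g (x ∷ xs) = begin
    sum (map f (g x ++ concatMap g xs))               ≡⟨ cong sum (map-++ f (g x) _) ⟩
    sum (map f (g x) ++ map f (concatMap g xs))       ≡⟨ sum-++ (map f (g x)) _ ⟩
    sum (map f (g x)) + sum (map f (concatMap g xs))  ≡⟨ cong (sum (map f (g x)) +_) (sum-map-concatMap f g xs) ⟩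
    sum (map f (g x)) + sum (map (λ y → sum (map f (g y))) xs) ∎
    where open ≡-Reasoning

  concatMap-pairs : ∀ {B : Set} (xs : List A) (ys : List B) →
                    concatMap (λ x → map (x ,_) ys) xs ≡ cartesianProduct xs ys
  concatMap-pairs []       ys = refl
  concatMap-pairs (x ∷ xs) ys = cong (map (x ,_) ys ++_) (concatMap-pairs xs ys)

  lookup-injective : (xs : List A) → Unique xs → ∀ i j → lookup xs i ≡ lookup xs j → i ≡ j
  lookup-injective (x ∷ xs) _            zero    zero    _  = refl
  lookup-injective (x ∷ xs) (x∉xs ∷ _)   zero    (suc j) x≡ = ⊥-elim (All.lookup x∉xs (∈-lookup j) x≡)
  lookup-injective (x ∷ xs) (x∉xs ∷ _)   (suc i) zero    ≡x = ⊥-elim (All.lookup x∉xs (∈-lookup i) (sym ≡x))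
  lookup-injective (x ∷ xs) (_ ∷ unique) (suc i) (suc j) eq = cong suc (lookup-injective xs unique i j eq)

-- Degrees, neighbourhoods and connectivity

module _ (G : Graph) where

  adj-sym : ∀ {x y b} → adj G x y ≡ b → adj G y x ≡ b
  adj-sym {x} {y} x~y = trans (Graph.sym G y x) x~y

  adj⇒≢ : ∀ {x y} → adj G x y ≡ true → x ≢ y
  adj⇒≢ {x} x~x refl = contradiction (trans (sym x~x) (irrefl G x)) λ ()

  degree≡count : ∀ x → degree G x ≡ count (adj G x)
  degree≡count x = sum-map-tabulate (iverson ∘ adj G x) id

  degree-≥1 : ∀ {x y} → adj G x y ≡ true → 1 ≤ degree G x
  degree-≥1 {x} x~y = subst (1 ≤_) (sym (degree≡count x)) (count-≥1 (adj G x) x~y)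

  degree-≥2 : ∀ {x y z} → adj G x y ≡ true → adj G x z ≡ true → y ≢ z → 2 ≤ degree G x
  degree-≥2 {x} x~y x~z y≢z = subst (2 ≤_) (sym (degree≡count x)) (count-≥2 (adj G x) x~y x~z y≢z)

  neighbour-unique : ∀ {x y z} → degree G x ≤ 1 → adj G x y ≡ true → adj G x z ≡ true → y ≡ z
  neighbour-unique {x} d≤1 = count≤1-unique (adj G x) (subst (_≤ 1) (degree≡count x) d≤1)

  neighbours-≤2 : ∀ {x y z t} → degree G x ≤ 2 → adj G x y ≡ true → adj G x z ≡ true → y ≢ z →
                  adj G x t ≡ true → t ≡ y ⊎ t ≡ z
  neighbours-≤2 {x} d≤2 = count≤2-cover (adj G x) (subst (_≤ 2) (degree≡count x) d≤2)

  other-neighbour : ∀ {x} → 2 ≤ degree G x → ∀ v → Σ (Fin (n G)) λ c → adj G x c ≡ true × c ≢ v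
  other-neighbour {x} 2≤d v =
    let y , z , x~y , x~z , y≢z = two-witnesses (adj G x) (subst (2 ≤_) (degree≡count x) 2≤d)
    in case y ≟ v of λ where
         (yes refl) → z , x~z , y≢z ∘ sym
         (no  y≢v)  → y , x~y , y≢v

  connected-closed : Connected G → (P : Fin (n G) → Set) → (∀ {x y} → adj G x y ≡ true → P x → P y) →
                     ∀ {x} → P x → ∀ y → P y
  connected-closed connected P closed {x} Px y = along (connected x y) Px
    where
    along : ∀ {u w} → Walk G u w → P u → P w
    along here              Pu = Pu
    along (step u~v v⇝w)    Pu = along v⇝w (closed u~v Pu)

-- Isomorphisms

PointDetermining : Graph → Set
PointDetermining H = ∀ i j → (∀ k → adj H i k ≡ adj H j k) → i ≡ j

≅-from-surjection : {G H : Graph} (f : Fin (n H) → Fin (n G)) → PointDetermining H →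
                    (∀ i j → adj G (f i) (f j) ≡ adj H i j) →
                    (∀ x → Σ (Fin (n H)) λ i → f i ≡ x) → G ≅ H
≅-from-surjection {G} {H} f point-determining f-adj onto = mk↔ₛ′ to f to∘f f∘to , to-adj
  where
  to : Fin (n G) → Fin (n H)
  to x = proj₁ (onto x)
  f∘to : ∀ x → f (to x) ≡ x
  f∘to x = proj₂ (onto x)
  to-adj : ∀ x y → adj G x y ≡ adj H (to x) (to y)
  to-adj x y = trans (sym (cong₂ (adj G) (f∘to x) (f∘to y))) (f-adj (to x) (to y))
  to∘f : ∀ i → to (f i) ≡ i
  to∘f i = point-determining (to (f i)) i λ k → begin
    adj H (to (f i)) k          ≡⟨ f-adj (to (f i)) k ⟨
    adj G (f (to (f i))) (f k)  ≡⟨ cong (λ x → adj G x (f k)) (f∘to (f i)) ⟩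
    adj G (f i) (f k)           ≡⟨ f-adj i k ⟩
    adj H i k                   ∎
    where open ≡-Reasoning

degree-≅ : {G H : Graph} (G≅H : G ≅ H) → ∀ x → degree G x ≡ degree H (Inverse.to (proj₁ G≅H) x)
degree-≅ {G} {H} (φ , φ-adj) x = begin
  degree G x                ≡⟨ degree≡count G x ⟩
  count (adj G x)           ≡⟨ count-cong (φ-adj x) ⟩
  count (adj H (to x) ∘ to) ≡⟨ count-permute φ (adj H (to x)) ⟩
  count (adj H (to x))      ≡⟨ degree≡count H (to x) ⟨
  degree H (to x)           ∎
  where
  open ≡-Reasoning
  open Inverse φ using (to)

-- Degrees in the line graph

module _ (G : Graph) where

  isEdge : Fin (n G) × Fin (n G) → Bool
  isEdge (u , v) = (toℕ u <ᵇ toℕ v) ∧ adj G u v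

  incident : Fin (n G) → Fin (n G) × Fin (n G) → Bool
  incident a (u , v) = does (a ≟ u) ∨ does (a ≟ v)

  allPairs : List (Fin (n G) × Fin (n G))
  allPairs = concatMap (λ u → map (u ,_) (allFin (n G))) (allFin (n G))

  private
    E = edgeAt G

  isEdge⁻ : ∀ {u v} → isEdge (u , v) ≡ true → toℕ u < toℕ v × adj G u v ≡ true
  isEdge⁻ {u} {v} uv =
    let u<v , u~v = ∧-true⁻ {toℕ u <ᵇ toℕ v} uv in <ᵇ⇒< (toℕ u) (toℕ v) (Equivalence.from T-≡ u<v) , u~v

  isEdge-irrefl : ∀ v → isEdge (v , v) ≡ false
  isEdge-irrefl v = trans (cong ((toℕ v <ᵇ toℕ v) ∧_) (irrefl G v)) (∧-zeroʳ _)

  isEdge-either : ∀ a v → isEdge (a , v) ∨ isEdge (v , a) ≡ adj G a v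
  isEdge-either a v with <-cmp (toℕ a) (toℕ v)
  ... | tri< a<v _ a≯v rewrite <ᵇ-true a<v | <ᵇ-false a≯v = ∨-identityʳ (adj G a v)
  ... | tri> a≮v _ a>v rewrite <ᵇ-false a≮v | <ᵇ-true a>v = Graph.sym G v a
  ... | tri≈ _ a≡v _ rewrite toℕ-injective a≡v | isEdge-irrefl v = sym (irrefl G v)

  isEdge-asym : ∀ a v → isEdge (a , v) ∧ isEdge (v , a) ≡ false
  isEdge-asym a v = ¬-not λ both →
    let av , va = ∧-true⁻ {isEdge (a , v)} both in <-asym (proj₁ (isEdge⁻ {a} {v} av)) (proj₁ (isEdge⁻ {v} {a} va))

  edge-isEdge : ∀ {e x y} → E e ≡ (x , y) → isEdge (x , y) ≡ true
  edge-isEdge {e} e≡xy = subst (λ p → isEdge p ≡ true) e≡xy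
    (Equivalence.to T-≡ (proj₂ (∈-filter⁻ (T? ∘ isEdge) {xs = allPairs} (∈-lookup e))))

  allPairs≡cartesianProduct : allPairs ≡ cartesianProduct (allFin (n G)) (allFin (n G))
  allPairs≡cartesianProduct = concatMap-pairs (allFin (n G)) (allFin (n G))

  edgeAt-onto : ∀ {u v} → isEdge (u , v) ≡ true → Σ (Fin (length (edges G))) λ e → E e ≡ (u , v)
  edgeAt-onto {u} {v} uv = index uv∈edges , sym (lookup-index uv∈edges)
    where
    uv∈edges : (u , v) ∈ edges G
    uv∈edges = ∈-filter⁺ (T? ∘ isEdge)
      (subst ((u , v) ∈_) (sym allPairs≡cartesianProduct) (∈-cartesianProduct⁺ (∈-allFin u) (∈-allFin v)))
      (Equivalence.from T-≡ uv)

  edgeAt-injective : ∀ e f → E e ≡ E f → e ≡ f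
  edgeAt-injective = lookup-injective (edges G) (filter⁺ (T? ∘ isEdge)
    (subst Unique (sym allPairs≡cartesianProduct) (cartesianProduct⁺ (allFin⁺ (n G)) (allFin⁺ (n G)))))

  count-edges : (q : Fin (n G) × Fin (n G) → Bool) →
                count (q ∘ E) ≡ ∑[ u < n G ] count (λ v → isEdge (u , v) ∧ q (u , v))
  count-edges q = begin
    count (q ∘ E)                                                ≡⟨ ∑-lookup (iverson ∘ q) (edges G) ⟩
    sum (map (iverson ∘ q) (edges G))                            ≡⟨ sum-map-filterᵇ isEdge q allPairs ⟩
    sum (map h allPairs)                                         ≡⟨ sum-map-concatMap h _ (allFin (n G)) ⟩
    sum (map (λ u → sum (map h (map (u ,_) (allFin (n G))))) (allFin (n G)))
                                                                 ≡⟨ sum-map-tabulate (λ u → sum (map h (map (u ,_) (allFin (n G))))) id ⟩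
    ∑[ u < n G ] sum (map h (map (u ,_) (allFin (n G))))         ≡⟨ sum-cong-≗ row ⟩
    ∑[ u < n G ] count (λ v → isEdge (u , v) ∧ q (u , v))        ∎
    where
    open ≡-Reasoning
    h : Fin (n G) × Fin (n G) → ℕ
    h p = iverson (isEdge p ∧ q p)
    row : ∀ u → sum (map h (map (u ,_) (allFin (n G)))) ≡ count (λ v → isEdge (u , v) ∧ q (u , v))
    row u = trans (cong sum (sym (map-∘ (allFin (n G))))) (sum-map-tabulate (h ∘ (u ,_)) id)

  incident-sound : ∀ {a u v} → incident a (u , v) ≡ true → a ≡ u ⊎ a ≡ v
  incident-sound {a} {u} {v} a∈uv with a ≟ u | a ≟ v
  ... | yes a≡u | _       = inj₁ a≡u
  ... | no  _   | yes a≡v = inj₂ a≡v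
  ... | no  _   | no  _   = contradiction a∈uv λ ()

  incident-complete : ∀ {a u v} → a ≡ u ⊎ a ≡ v → incident a (u , v) ≡ true
  incident-complete {a} (inj₁ refl) rewrite dec-true (a ≟ a) refl = refl
  incident-complete {a} (inj₂ refl) rewrite dec-true (a ≟ a) refl = ∨-zeroʳ _

  -- An edge at a is listed either as (a , v) with a < v or as (u , a) with u < a.
  count-incident-split : ∀ a → count (incident a ∘ E) ≡ count (λ v → isEdge (a , v)) + count (λ u → isEdge (u , a))
  count-incident-split a = begin
    count (incident a ∘ E)
      ≡⟨ count-edges (incident a) ⟩
    ∑[ u < n G ] count (λ v → isEdge (u , v) ∧ (does (a ≟ u) ∨ does (a ≟ v)))
      ≡⟨ sum-cong-≗ split ⟩
    ∑[ u < n G ] (count (λ v → does (a ≟ u) ∧ isEdge (u , v)) + count (λ v → does (a ≟ v) ∧ isEdge (u , v)))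
      ≡⟨ ∑-distrib-+ (λ u → count (λ v → does (a ≟ u) ∧ isEdge (u , v)))
                     (λ u → count (λ v → does (a ≟ v) ∧ isEdge (u , v))) ⟩
    ∑[ u < n G ] count (λ v → does (a ≟ u) ∧ isEdge (u , v)) + ∑[ u < n G ] count (λ v → does (a ≟ v) ∧ isEdge (u , v))
      ≡⟨ cong₂ _+_ (∑-δ _ a off-a) (sum-cong-≗ (λ u → count-∧-≟ (λ v → isEdge (u , v)) a)) ⟩
    count (λ v → does (a ≟ a) ∧ isEdge (a , v)) + count (λ u → isEdge (u , a))
      ≡⟨ cong (λ d → count (λ v → d ∧ isEdge (a , v)) + count (λ u → isEdge (u , a))) (dec-true (a ≟ a) refl) ⟩
    count (λ v → isEdge (a , v)) + count (λ u → isEdge (u , a))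
      ∎
    where
    open ≡-Reasoning
    split : ∀ u → count (λ v → isEdge (u , v) ∧ (does (a ≟ u) ∨ does (a ≟ v))) ≡
                  count (λ v → does (a ≟ u) ∧ isEdge (u , v)) + count (λ v → does (a ≟ v) ∧ isEdge (u , v))
    split u = trans (count-cong distrib) (count-∨-disjoint _ _ disjoint)
      where
      distrib : ∀ v → isEdge (u , v) ∧ (does (a ≟ u) ∨ does (a ≟ v)) ≡
                      (does (a ≟ u) ∧ isEdge (u , v)) ∨ (does (a ≟ v) ∧ isEdge (u , v))
      distrib v = trans (∧-distribˡ-∨ (isEdge (u , v)) (does (a ≟ u)) (does (a ≟ v)))
                        (cong₂ _∨_ (∧-comm (isEdge (u , v)) _) (∧-comm (isEdge (u , v)) _))
      disjoint : ∀ v → (does (a ≟ u) ∧ isEdge (u , v)) ∧ (does (a ≟ v) ∧ isEdge (u , v)) ≡ false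
      disjoint v with a ≟ u | a ≟ v
      ... | yes refl | yes refl rewrite isEdge-irrefl a = refl
      ... | yes _    | no  _    = ∧-zeroʳ _
      ... | no  _    | _        = refl
    off-a : ∀ u → u ≢ a → count (λ v → does (a ≟ u) ∧ isEdge (u , v)) ≡ 0
    off-a u u≢a = count-false (λ v → cong (_∧ isEdge (u , v)) (dec-false (a ≟ u) (u≢a ∘ sym)))

  count-incident : ∀ a → count (incident a ∘ E) ≡ degree G a
  count-incident a = begin
    count (incident a ∘ E)                                        ≡⟨ count-incident-split a ⟩
    count (λ v → isEdge (a , v)) + count (λ v → isEdge (v , a))   ≡⟨ count-∨-disjoint _ _ (isEdge-asym a) ⟨
    count (λ v → isEdge (a , v) ∨ isEdge (v , a))                 ≡⟨ count-cong (isEdge-either a) ⟩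
    count (adj G a)                                               ≡⟨ degree≡count G a ⟨
    degree G a                                                    ∎
    where open ≡-Reasoning

  Joins : Fin (length (edges G)) → Fin (n G) → Fin (n G) → Set
  Joins e x y = E e ≡ (x , y) ⊎ E e ≡ (y , x)

  joins-sym : ∀ {e x y} → Joins e x y → Joins e y x
  joins-sym = ⊎-swap

  joins-adj : ∀ {e x y} → Joins e x y → adj G x y ≡ true
  joins-adj (inj₁ e≡xy) = proj₂ (isEdge⁻ (edge-isEdge e≡xy))
  joins-adj (inj₂ e≡yx) = adj-sym G (proj₂ (isEdge⁻ (edge-isEdge e≡yx)))

  adj⇒joins : ∀ {x y} → adj G x y ≡ true → Σ (Fin (length (edges G))) λ e → Joins e x y
  adj⇒joins {x} {y} x~y with <-cmp (toℕ x) (toℕ y)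
  ... | tri< x<y _ _ = let e , e≡xy = edgeAt-onto (cong₂ _∧_ (<ᵇ-true x<y) x~y) in e , inj₁ e≡xy
  ... | tri> _ _ y<x = let e , e≡yx = edgeAt-onto (cong₂ _∧_ (<ᵇ-true y<x) (adj-sym G x~y)) in e , inj₂ e≡yx
  ... | tri≈ _ x≡y _ = contradiction (toℕ-injective x≡y) (adj⇒≢ G x~y)

  joins-functional : ∀ {e v u w} → Joins e v u → Joins e v w → u ≡ w
  joins-functional (inj₁ e≡vu) (inj₁ e≡vw) = cong proj₂ (trans (sym e≡vu) e≡vw)
  joins-functional (inj₁ e≡vu) (inj₂ e≡wv) = trans (cong proj₂ (trans (sym e≡vu) e≡wv)) (cong proj₁ (trans (sym e≡vu) e≡wv))
  joins-functional (inj₂ e≡uv) (inj₁ e≡vw) = trans (cong proj₁ (trans (sym e≡uv) e≡vw)) (cong proj₂ (trans (sym e≡uv) e≡vw))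
  joins-functional (inj₂ e≡uv) (inj₂ e≡wv) = cong proj₁ (trans (sym e≡uv) e≡wv)

  joins-injective : ∀ {e f x y} → Joins e x y → Joins f x y → e ≡ f
  joins-injective {e} {f} (inj₁ e≡xy) (inj₁ f≡xy) = edgeAt-injective e f (trans e≡xy (sym f≡xy))
  joins-injective {e} {f} (inj₂ e≡yx) (inj₂ f≡yx) = edgeAt-injective e f (trans e≡yx (sym f≡yx))
  joins-injective (inj₁ e≡xy) (inj₂ f≡yx) = ⊥-elim (<-asym (proj₁ (isEdge⁻ (edge-isEdge e≡xy))) (proj₁ (isEdge⁻ (edge-isEdge f≡yx))))
  joins-injective (inj₂ e≡yx) (inj₁ f≡xy) = ⊥-elim (<-asym (proj₁ (isEdge⁻ (edge-isEdge e≡yx))) (proj₁ (isEdge⁻ (edge-isEdge f≡xy))))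

  joins-incident : ∀ {e x y} → Joins e x y → incident x (E e) ≡ true
  joins-incident {x = x} {y} (inj₁ e≡xy) = subst (λ p → incident x p ≡ true) (sym e≡xy) (incident-complete {x} {x} {y} (inj₁ refl))
  joins-incident {x = x} {y} (inj₂ e≡yx) = subst (λ p → incident x p ≡ true) (sym e≡yx) (incident-complete {x} {y} {x} (inj₂ refl))

  incident⇒joins : ∀ {e v} → incident v (E e) ≡ true → Σ (Fin (n G)) λ u → Joins e v u
  incident⇒joins {e} {v} v∈e with incident-sound {v} {proj₁ (E e)} {proj₂ (E e)} v∈e
  ... | inj₁ refl = proj₂ (E e) , inj₁ refl
  ... | inj₂ refl = proj₁ (E e) , inj₂ refl

  incident-both⇒joins : ∀ {e a b} → a ≢ b → incident a (E e) ≡ true → incident b (E e) ≡ true → Joins e a b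
  incident-both⇒joins {e} {a} {b} a≢b a∈e b∈e
    with incident-sound {a} {proj₁ (E e)} {proj₂ (E e)} a∈e | incident-sound {b} {proj₁ (E e)} {proj₂ (E e)} b∈e
  ... | inj₁ refl | inj₁ refl = contradiction refl a≢b
  ... | inj₁ refl | inj₂ refl = inj₁ refl
  ... | inj₂ refl | inj₁ refl = inj₂ refl
  ... | inj₂ refl | inj₂ refl = contradiction refl a≢b

  shareEnd-incident : (x y : Fin (n G)) (q : Fin (n G) × Fin (n G)) → shareEnd (x , y) q ≡ incident x q ∨ incident y q
  shareEnd-incident x y (u , v) = sym (∨-assoc (does (x ≟ u)) (does (x ≟ v)) (incident y (u , v)))

  shareEnd-refl : (p : Fin (n G) × Fin (n G)) → shareEnd p p ≡ true
  shareEnd-refl (a , b) rewrite dec-true (a ≟ a) refl = refl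

  -- Inclusion–exclusion: an edge meets e iff it is incident to a or to b, and only e is incident to both.
  degree-L : ∀ {e a b} → Joins e a b → degree G a + degree G b ≡ 2 + degree (L G) e
  degree-L {e} {a} {b} e-ab = begin
    degree G a + degree G b
      ≡⟨ cong₂ _+_ (count-incident a) (count-incident b) ⟨
    count (incident a ∘ E) + count (incident b ∘ E)
      ≡⟨ count-∨-∧ (incident a ∘ E) (incident b ∘ E) ⟨
    count (λ j → incident a (E j) ∨ incident b (E j)) + count (λ j → incident a (E j) ∧ incident b (E j))
      ≡⟨ cong₂ _+_ (count-cong shares) (count-cong only-e) ⟩
    count (λ j → shareEnd (E e) (E j)) + count (λ j → does (e ≟ j))
      ≡⟨ cong₂ _+_ (count-remove (λ j → shareEnd (E e) (E j)) e (shareEnd-refl (E e))) (count-≟ e) ⟩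
    suc (count (lineAdj G e)) + 1
      ≡⟨ cong (λ d → suc d + 1) (degree≡count (L G) e) ⟨
    suc (degree (L G) e) + 1
      ≡⟨ +-comm (suc (degree (L G) e)) 1 ⟩
    2 + degree (L G) e
      ∎
    where
    open ≡-Reasoning
    shares : ∀ j → incident a (E j) ∨ incident b (E j) ≡ shareEnd (E e) (E j)
    shares j = [ (λ e≡ab → sym (trans (cong (λ p → shareEnd p (E j)) e≡ab) (shareEnd-incident a b (E j))))
               , (λ e≡ba → trans (∨-comm (incident a (E j)) _)
                                  (sym (trans (cong (λ p → shareEnd p (E j)) e≡ba) (shareEnd-incident b a (E j)))))
               ]′ e-ab
    only-e : ∀ j → incident a (E j) ∧ incident b (E j) ≡ does (e ≟ j)
    only-e j with e ≟ j
    ... | yes refl = cong₂ _∧_ (joins-incident e-ab) (joins-incident (joins-sym e-ab))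
    ... | no  e≢j  = ¬-not λ both → let a∈j , b∈j = ∧-true⁻ {incident a (E j)} both in
      e≢j (joins-injective e-ab (incident-both⇒joins (adj⇒≢ G (joins-adj e-ab)) a∈j b∈j))

  shareEnd⇒common : (p q : Fin (n G) × Fin (n G)) → shareEnd p q ≡ true → Σ (Fin (n G)) λ v → incident v p ≡ true × incident v q ≡ true
  shareEnd⇒common (a , b) q share with ∨-true⁻ {incident a q} (trans (sym (shareEnd-incident a b q)) share)
  ... | inj₁ a∈q = a , incident-complete {a} {a} {b} (inj₁ refl) , a∈q
  ... | inj₂ b∈q = b , incident-complete {b} {a} {b} (inj₂ refl) , b∈q

  common⇒shareEnd : ∀ {v} (p q : Fin (n G) × Fin (n G)) → incident v p ≡ true → incident v q ≡ true → shareEnd p q ≡ true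
  common⇒shareEnd {v} (a , b) q v∈p v∈q with incident-sound {v} {a} {b} v∈p
  ... | inj₁ refl = trans (shareEnd-incident a b q) (∨-true⁺ (inj₁ v∈q))
  ... | inj₂ refl = trans (shareEnd-incident a b q) (∨-true⁺ {incident a q} (inj₂ v∈q))

  lineAdj⇒joins : ∀ {e f} → lineAdj G e f ≡ true →
                  Σ (Fin (n G)) λ v → Σ (Fin (n G)) λ u → Σ (Fin (n G)) λ w → Joins e v u × Joins f v w × u ≢ w
  lineAdj⇒joins {e} {f} e~f =
    let share , f≢e  = ∖-true⁻ (λ j → shareEnd (E e) (E j)) e e~f
        v , v∈e , v∈f = shareEnd⇒common (E e) (E f) share
        u , e-vu      = incident⇒joins v∈e
        w , f-vw      = incident⇒joins v∈f
    in v , u , w , e-vu , f-vw , λ u≡w → f≢e (joins-injective (subst (Joins f v) (sym u≡w) f-vw) e-vu)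

  joins⇒lineAdj : ∀ {e f v u w} → Joins e v u → Joins f v w → u ≢ w → lineAdj G e f ≡ true
  joins⇒lineAdj {e} {f} {v} e-vu f-vw u≢w =
    ∖-true⁺ (λ j → shareEnd (E e) (E j)) (common⇒shareEnd {v} (E e) (E f) (joins-incident e-vu) (joins-incident f-vw))
      λ f≡e → u≢w (joins-functional e-vu (subst (λ k → Joins k v _) f≡e f-vw))

-- Stepwise irregular line graphs

DifferByOne : ℕ → ℕ → Set
DifferByOne m n = m ≡ suc n ⊎ n ≡ suc m

+-transfer-suc : ∀ {k l n p q} → k + suc n ≡ l + p → k + n ≡ l + q → p ≡ suc q
+-transfer-suc {k} {l} {n} {p} {q} k+1+n≡l+p k+n≡l+q = +-cancelˡ-≡ l p (suc q) (begin
  l + p       ≡⟨ k+1+n≡l+p ⟨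
  k + suc n   ≡⟨ +-suc k n ⟩
  suc (k + n) ≡⟨ cong suc k+n≡l+q ⟩
  suc (l + q) ≡⟨ +-suc l q ⟨
  l + suc q   ∎)
  where open ≡-Reasoning

differByOne-transfer : ∀ {k l m n p q} → k + m ≡ l + p → k + n ≡ l + q → DifferByOne m n → DifferByOne p q
differByOne-transfer km≡lp kn≡lq (inj₁ refl) = inj₁ (+-transfer-suc km≡lp kn≡lq)
differByOne-transfer km≡lp kn≡lq (inj₂ refl) = inj₂ (+-transfer-suc kn≡lq km≡lp)

differByOne-no-triangle : ∀ {a b c} → DifferByOne a b → DifferByOne b c → DifferByOne a c → ⊥
differByOne-no-triangle (inj₁ refl) (inj₁ refl) (inj₁ ())
differByOne-no-triangle (inj₁ refl) (inj₁ refl) (inj₂ ())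
differByOne-no-triangle (inj₁ refl) (inj₂ refl) (inj₁ ())
differByOne-no-triangle (inj₁ refl) (inj₂ refl) (inj₂ ())
differByOne-no-triangle (inj₂ refl) (inj₁ refl) (inj₁ ())
differByOne-no-triangle (inj₂ refl) (inj₁ refl) (inj₂ ())
differByOne-no-triangle (inj₂ refl) (inj₂ refl) (inj₁ ())
differByOne-no-triangle (inj₂ refl) (inj₂ refl) (inj₂ ())

NeighbourDegreesDifferByOne : Graph → Set
NeighbourDegreesDifferByOne G = ∀ {v u w} → adj G v u ≡ true → adj G v w ≡ true → u ≢ w →
                                DifferByOne (degree G u) (degree G w)

stepwiseIrregular-L⇔ : (G : Graph) → StepwiseIrregular (L G) ⇔ NeighbourDegreesDifferByOne G
stepwiseIrregular-L⇔ G = mk⇔ to from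
  where
  to : StepwiseIrregular (L G) → NeighbourDegreesDifferByOne G
  to si v~u v~w u≢w =
    let e , e-vu = adj⇒joins G v~u
        f , f-vw = adj⇒joins G v~w
    in differByOne-transfer (sym (degree-L G e-vu)) (sym (degree-L G f-vw))
        (si e f (joins⇒lineAdj G e-vu f-vw u≢w))
  from : NeighbourDegreesDifferByOne G → StepwiseIrregular (L G)
  from nd e f e~f =
    let v , u , w , e-vu , f-vw , u≢w = lineAdj⇒joins G e~f
    in differByOne-transfer (degree-L G e-vu) (degree-L G f-vw)
        (nd (joins-adj G e-vu) (joins-adj G f-vw) u≢w)

neighbourDegrees-≅ : {G H : Graph} → G ≅ H → NeighbourDegreesDifferByOne H → NeighbourDegreesDifferByOne G
neighbourDegrees-≅ {G} {H} G≅H@(φ , φ-adj) nd {v} {u} {w} v~u v~w u≢w =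
  subst₂ DifferByOne (sym (degree-≅ {G} {H} G≅H u)) (sym (degree-≅ {G} {H} G≅H w))
    (nd (trans (sym (φ-adj v u)) v~u) (trans (sym (φ-adj v w)) v~w) (u≢w ∘ to-injective))
  where
  open Inverse φ
  to-injective : to u ≡ to w → u ≡ w
  to-injective tu≡tw = trans (sym (strictlyInverseʳ u)) (trans (cong from tu≡tw) (strictlyInverseʳ w))

P₄-neighbourDegrees : NeighbourDegreesDifferByOne P₄
P₄-neighbourDegrees {v} {u} {w} = from-yes (all? λ v → all? λ u → all? λ w → check v u w) v u w
  where
  check : ∀ v u w → Dec (p4adj v u ≡ true → p4adj v w ≡ true → u ≢ w → DifferByOne (degree P₄ u) (degree P₄ w))
  check v u w = (p4adj v u Bool.≟ true) →-dec (p4adj v w Bool.≟ true) →-dec ¬? (u ≟ w) →-dec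
                ((degree P₄ u ℕ.≟ suc (degree P₄ w)) ⊎-dec (degree P₄ w ℕ.≟ suc (degree P₄ u)))

P₄-pointDetermining : PointDetermining P₄
P₄-pointDetermining = from-yes (all? λ i → all? λ j → all? (λ k → p4adj i k Bool.≟ p4adj j k) →-dec (i ≟ j))

three-distinct : ∀ {m} → 3 ≤ m → Σ (Fin m) λ x → Σ (Fin m) λ y → Σ (Fin m) λ z → x ≢ y × x ≢ z × y ≢ z
three-distinct {suc (suc (suc _))} (s≤s (s≤s (s≤s _))) = 0F , 1F , 2F , (λ ()) , (λ ()) , (λ ())

record Cherry (G : Graph) : Set where
  constructor cherry
  field
    {centre leaf₁ leaf₂} : Fin (n G)
    centre~leaf₁ : adj G centre leaf₁ ≡ true
    centre~leaf₂ : adj G centre leaf₂ ≡ true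
    leaf₁≢leaf₂  : leaf₁ ≢ leaf₂

module _ {G : Graph} where

  walk-short-or-cherry : ∀ {x y} → Walk G x y → y ≡ x ⊎ adj G x y ≡ true ⊎ Cherry G
  walk-short-or-cherry here = inj₁ refl
  walk-short-or-cherry {x} {y} (step x~w w⇝y) with walk-short-or-cherry w⇝y
  ... | inj₁ refl          = inj₂ (inj₁ x~w)
  ... | inj₂ (inj₂ ch)     = inj₂ (inj₂ ch)
  ... | inj₂ (inj₁ w~y) with y ≟ x
  ...   | yes y≡x = inj₁ y≡x
  ...   | no  y≢x = inj₂ (inj₂ (cherry (adj-sym G x~w) w~y (y≢x ∘ sym)))

  cherry-exists : Connected G → 3 ≤ n G → Cherry G
  cherry-exists connected 3≤n
    with x , y , z , x≢y , x≢z , y≢z ← three-distinct 3≤n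
    with walk-short-or-cherry (connected x y) | walk-short-or-cherry (connected x z)
  ... | inj₁ y≡x        | _               = contradiction (sym y≡x) x≢y
  ... | _               | inj₁ z≡x        = contradiction (sym z≡x) x≢z
  ... | inj₂ (inj₂ ch)  | _               = ch
  ... | _               | inj₂ (inj₂ ch)  = ch
  ... | inj₂ (inj₁ x~y) | inj₂ (inj₁ x~z) = cherry x~y x~z y≢z

  module _ (nd : NeighbourDegreesDifferByOne G) where

    no-three-neighbours : ∀ {x y z w} → adj G x y ≡ true → adj G x z ≡ true → adj G x w ≡ true →
                          y ≢ z → y ≢ w → z ≢ w → ⊥
    no-three-neighbours x~y x~z x~w y≢z y≢w z≢w =
      differByOne-no-triangle (nd x~y x~z y≢z) (nd x~z x~w z≢w) (nd x~y x~w y≢w)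

    degree≤2 : ∀ x → degree G x ≤ 2
    degree≤2 x = ≮⇒≥ λ 3≤d →
      let y , z , w , x~y , x~z , x~w , y≢z , y≢w , z≢w =
            three-witnesses (adj G x) (subst (3 ≤_) (degree≡count G x) 3≤d)
      in no-three-neighbours x~y x~z x~w y≢z y≢w z≢w

    module Spine (connected : Connected G) {v a b : Fin (n G)}
                 (v~a : adj G v a ≡ true) (v~b : adj G v b ≡ true) (a≢b : a ≢ b)
                 (d[b]≡1+d[a] : degree G b ≡ suc (degree G a)) where

      d[v]≡2 : degree G v ≡ 2
      d[v]≡2 = ≤-antisym (degree≤2 v) (degree-≥2 G v~a v~b a≢b)

      d[a]≡1 : degree G a ≡ 1
      d[a]≡1 = ≤-antisym (s≤s⁻¹ (subst (_≤ 2) d[b]≡1+d[a] (degree≤2 b))) (degree-≥1 G (adj-sym G v~a))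

      d[b]≡2 : degree G b ≡ 2
      d[b]≡2 = trans d[b]≡1+d[a] (cong suc d[a]≡1)

      fourth : Σ (Fin (n G)) λ c → adj G b c ≡ true × c ≢ v
      fourth = other-neighbour G (≤-reflexive (sym d[b]≡2)) v

      c : Fin (n G)
      c = proj₁ fourth

      b~c : adj G b c ≡ true
      b~c = proj₁ (proj₂ fourth)

      c≢v : c ≢ v
      c≢v = proj₂ (proj₂ fourth)

      d[c]≡1 : degree G c ≡ 1
      d[c]≡1 = [ (λ d[c]≡1+d[v] → contradiction (degree≤2 c)
                                      (<⇒≱ (≤-reflexive (sym (trans d[c]≡1+d[v] (cong suc d[v]≡2))))))
               , (λ d[v]≡1+d[c] → suc-injective (trans (sym d[v]≡1+d[c]) d[v]≡2))
               ]′ (nd b~c (adj-sym G v~b) c≢v)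

      a-neighbour : ∀ {t} → adj G a t ≡ true → t ≡ v
      a-neighbour a~t = neighbour-unique G (≤-reflexive d[a]≡1) a~t (adj-sym G v~a)

      v-neighbours : ∀ {t} → adj G v t ≡ true → t ≡ a ⊎ t ≡ b
      v-neighbours = neighbours-≤2 G (degree≤2 v) v~a v~b a≢b

      b-neighbours : ∀ {t} → adj G b t ≡ true → t ≡ v ⊎ t ≡ c
      b-neighbours = neighbours-≤2 G (degree≤2 b) (adj-sym G v~b) b~c (c≢v ∘ sym)

      c-neighbour : ∀ {t} → adj G c t ≡ true → t ≡ b
      c-neighbour c~t = neighbour-unique G (≤-reflexive d[c]≡1) c~t (adj-sym G b~c)

      a≁b : adj G a b ≡ false
      a≁b = ¬-not λ a~b → adj⇒≢ G v~b (sym (a-neighbour a~b))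

      a≁c : adj G a c ≡ false
      a≁c = ¬-not λ a~c → c≢v (a-neighbour a~c)

      v≁c : adj G v c ≡ false
      v≁c = ¬-not λ v~c →
        [ (λ c≡a → adj⇒≢ G v~b (sym (a-neighbour (adj-sym G (subst (λ t → adj G b t ≡ true) c≡a b~c)))))
        , (λ c≡b → adj⇒≢ G b~c (sym c≡b))
        ]′ (v-neighbours v~c)

      spine : Fin 4 → Fin (n G)
      spine 0F = a
      spine 1F = v
      spine 2F = b
      spine 3F = c

      spine-adj : ∀ i j → adj G (spine i) (spine j) ≡ p4adj i j
      spine-adj 0F 0F = irrefl G a
      spine-adj 0F 1F = adj-sym G v~a
      spine-adj 0F 2F = a≁b
      spine-adj 0F 3F = a≁c
      spine-adj 1F 0F = v~a
      spine-adj 1F 1F = irrefl G v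
      spine-adj 1F 2F = v~b
      spine-adj 1F 3F = v≁c
      spine-adj 2F 0F = adj-sym G a≁b
      spine-adj 2F 1F = adj-sym G v~b
      spine-adj 2F 2F = irrefl G b
      spine-adj 2F 3F = b~c
      spine-adj 3F 0F = adj-sym G a≁c
      spine-adj 3F 1F = adj-sym G v≁c
      spine-adj 3F 2F = adj-sym G b~c
      spine-adj 3F 3F = irrefl G c

      InSpine : Fin (n G) → Set
      InSpine x = Σ (Fin 4) λ i → spine i ≡ x

      spine-closed : ∀ {x y} → adj G x y ≡ true → InSpine x → InSpine y
      spine-closed a~y (0F , refl) = 1F , sym (a-neighbour a~y)
      spine-closed v~y (1F , refl) = [ (λ y≡a → 0F , sym y≡a) , (λ y≡b → 2F , sym y≡b) ]′ (v-neighbours v~y)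
      spine-closed b~y (2F , refl) = [ (λ y≡v → 1F , sym y≡v) , (λ y≡c → 3F , sym y≡c) ]′ (b-neighbours b~y)
      spine-closed c~y (3F , refl) = 2F , sym (c-neighbour c~y)

      G≅P₄ : G ≅ P₄
      G≅P₄ = ≅-from-surjection {G} {P₄} spine P₄-pointDetermining spine-adj
               (connected-closed G connected InSpine spine-closed (0F , refl))

    P₄-from-cherry : Connected G → Cherry G → G ≅ P₄
    P₄-from-cherry connected (cherry v~a v~b a≢b) =
      [ Spine.G≅P₄ connected v~b v~a (a≢b ∘ sym) , Spine.G≅P₄ connected v~a v~b a≢b ]′ (nd v~a v~b a≢b)

mainTheorem18 : (G : Graph) → Connected G → 3 ≤ n G →
    (G ≅ P₄) ⇔ StepwiseIrregular (L G)
mainTheorem18 G connected 3≤n = mk⇔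
  (λ G≅P₄ → from (neighbourDegrees-≅ {G} {P₄} G≅P₄ P₄-neighbourDegrees))
  (λ si → P₄-from-cherry (to si) connected (cherry-exists connected 3≤n))
  where open Equivalence (stepwiseIrregular-L⇔ G)
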